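{- Let $\mathbb{K}$ be a field of characteristic $0$ and $\mathcal{H}$ the $\mathbb{K}$-vector space freely spanned by totally assigned graphs (TAGs), with product $m\big((\Gamma_1,\mu_1),(\Gamma_2,\mu_2)\big)=(\Gamma_1\sqcup\Gamma_2,\mu_1\sqcup\mu_2)$ and coproduct $\Delta\big((\Gamma,\mu)\big)=\sum_{\emptyset\subseteq(\gamma,\nu)\subseteq(\Gamma,\mu)}(\gamma,\nu)\otimes(\Gamma/\gamma,\mu/\nu)$. Then for any two TAGs $(\Gamma_1,\mu_1)$, $(\Gamma_2,\mu_2)$, $$\Delta\Big(m\big((\Gamma_1,\mu_1),(\Gamma_2,\mu_2)\big)\Big)=m^{\otimes 2}\circ\tau_{23}\big(\Delta(\Gamma_1,\mu_1)\otimes\Delta(\Gamma_2,\mu_2)\big),$$ where $\tau_{23}$ is the flip of the two middle tensor factors in $\mathcal{H}^{\otimes 4}$.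
   Context: Graphs are finite, possibly disconnected, with loops and multiple edges allowed; $E(\Gamma)$ is the edge set. A TAG is a pair $(\Gamma,\mu)$ where $\mu$ is a total order on $E(\Gamma)$. $\Gamma_1\sqcup\Gamma_2$ is the disjoint union of graphs and $\mu_1\sqcup\mu_2$ is the ordinal sum order: it restricts to $\mu_i$ on $E(\Gamma_i)$ and every edge of $\Gamma_1$ precedes every edge of $\Gamma_2$. A subgraph $\gamma$ of $\Gamma$ is formed by a subset of $E(\Gamma)$ together with the vertices incident to these edges. A totally assigned subgraph $(\gamma,\nu)$ carries the restricted order $\nu=\mu|_{E(\gamma)}$. The shrinking $(\Gamma/\gamma,\mu/\nu)$: contract each connected component of $\gamma$ to a point, and restrict $\mu$ to the edges of $\Gamma$ not in $\gamma$. -}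

module Defs where

open import Level using (Level; _⊔_) renaming (suc to lsuc)
open import Data.Nat using (ℕ; zero; suc) renaming (_+_ to _+ℕ_)
open import Data.Fin using (Fin; _↑ˡ_; _↑ʳ_; splitAt)
open import Data.Fin.Properties using (_≟_)
open import Data.Bool using (Bool; true; false; _∨_; _∧_; not; if_then_else_; T)
open import Data.List using (List; []; _∷_; _++_; map; length; concatMap)
open import Data.Bool.ListAction using (any)
open import Data.List.Relation.Binary.Pointwise using (Pointwise)
open import Data.Product using (_×_; _,_; proj₁; proj₂; ∃)
open import Data.Sum using (_⊎_; inj₁; inj₂)
open import Relation.Nullary using (¬_; does)
open import Relation.Binary.PropositionalEquality using (_≡_)
open import Algebra.Bundles using (CommutativeRing)

record Field (c ℓ : Level) : Set (lsuc (c ⊔ ℓ)) where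
  field
    commutativeRing : CommutativeRing c ℓ
  open CommutativeRing commutativeRing public
  field
    1≉0     : ¬ (1# ≈ 0#)
    inverse : ∀ x → ¬ (x ≈ 0#) → ∃ λ y → (x * y) ≈ 1#

module _ {c ℓ} (K : Field c ℓ) where
  open Field K

  natK : ℕ → Carrier
  natK zero    = 0#
  natK (suc n) = 1# + natK n

  CharacteristicZero : Set ℓ
  CharacteristicZero = ∀ n → ¬ (natK (suc n) ≈ 0#)

-- Free K-vector space on a setoid-like basis (B , _∼_):
-- formal finite linear combinations modulo the linear relations.

FreeVec : ∀ {c ℓ} → Field c ℓ → ∀ {b} → Set b → Set (c ⊔ b)
FreeVec K B = List (Field.Carrier K × B)

module FreeVecOps {c ℓ} (K : Field c ℓ) where
  open Field K

  data Eq {b r} {B : Set b} (_∼_ : B → B → Set r)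
          : FreeVec K B → FreeVec K B → Set (c ⊔ ℓ ⊔ b ⊔ r) where
    eq-refl  : ∀ {xs} → Eq _∼_ xs xs
    eq-sym   : ∀ {xs ys} → Eq _∼_ xs ys → Eq _∼_ ys xs
    eq-trans : ∀ {xs ys zs} → Eq _∼_ xs ys → Eq _∼_ ys zs → Eq _∼_ xs zs
    eq-tail  : ∀ {x xs ys} → Eq _∼_ xs ys → Eq _∼_ (x ∷ xs) (x ∷ ys)
    eq-head  : ∀ {c₁ c₂ b₁ b₂ xs} → c₁ ≈ c₂ → b₁ ∼ b₂ →
               Eq _∼_ ((c₁ , b₁) ∷ xs) ((c₂ , b₂) ∷ xs)
    eq-swap  : ∀ {x y xs} → Eq _∼_ (x ∷ y ∷ xs) (y ∷ x ∷ xs)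
    eq-merge : ∀ {c₁ c₂ b xs} →
               Eq _∼_ ((c₁ , b) ∷ (c₂ , b) ∷ xs) ((c₁ + c₂ , b) ∷ xs)
    eq-zero  : ∀ {b xs} → Eq _∼_ ((0# , b) ∷ xs) xs

  linMap : ∀ {b b'} {B : Set b} {B' : Set b'} → (B → B') → FreeVec K B → FreeVec K B'
  linMap f = map (λ t → proj₁ t , f (proj₂ t))

  -- tensor product of two vectors, as a vector in the free space on pairs
  -- (the tensor product of free spaces is free on the product basis)
  _⊗_ : ∀ {b b'} {B : Set b} {B' : Set b'} → FreeVec K B → FreeVec K B' → FreeVec K (B × B')
  xs ⊗ ys = concatMap (λ x → map (λ y → (proj₁ x * proj₁ y , (proj₂ x , proj₂ y))) ys) xs

-- A presentation has vertices among Fin n, an ordered list of edges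
-- (each an unordered pair of endpoints, stored as a pair; loops and
-- multiple edges allowed); the list order is the total order μ on E(Γ).
-- The vertex set of Γ is the set of vertices marked by 'mark' together
-- with all endpoints of edges (so 'mark' records isolated vertices).

Edge : ℕ → Set
Edge n = Fin n × Fin n

record TAG : Set where
  constructor tag
  field
    n     : ℕ
    mark  : Fin n → Bool
    edges : List (Edge n)
open TAG public

incident : ∀ {n} → Fin n → List (Edge n) → Bool
incident w es = any (λ e → does (w ≟ proj₁ e) ∨ does (w ≟ proj₂ e)) es

isVertex : (Γ : TAG) → Fin (n Γ) → Bool
isVertex Γ w = mark Γ w ∨ incident w (edges Γ)

-- isomorphism of TAGs: a bijection of vertex sets carrying the edge list
-- onto the edge list position by position (hence preserving the order)
-- and respecting endpoints (as unordered pairs)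
record _≅_ (Γ Δ : TAG) : Set where
  field
    f       : Fin (n Γ) → Fin (n Δ)
    g       : Fin (n Δ) → Fin (n Γ)
    f-vert  : ∀ w → T (isVertex Γ w) → T (isVertex Δ (f w))
    g-vert  : ∀ w → T (isVertex Δ w) → T (isVertex Γ (g w))
    gf      : ∀ w → T (isVertex Γ w) → g (f w) ≡ w
    fg      : ∀ w → T (isVertex Δ w) → f (g w) ≡ w
    edgeMap : Pointwise
                (λ e e' → (f (proj₁ e) ≡ proj₁ e' × f (proj₂ e) ≡ proj₂ e')
                        ⊎ (f (proj₁ e) ≡ proj₂ e' × f (proj₂ e) ≡ proj₁ e'))
                (edges Γ) (edges Δ)

-- product: disjoint union with ordinal-sum order on edges
_⊔ᵀ_ : TAG → TAG → TAG
tag n₁ m₁ es₁ ⊔ᵀ tag n₂ m₂ es₂ =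
  tag (n₁ +ℕ n₂) mk
      (map (λ e → (proj₁ e ↑ˡ n₂ , proj₂ e ↑ˡ n₂)) es₁
       ++ map (λ e → (n₁ ↑ʳ proj₁ e , n₁ ↑ʳ proj₂ e)) es₂)
  where
    mk : Fin (n₁ +ℕ n₂) → Bool
    mk w with splitAt n₁ w
    ... | inj₁ w₁ = m₁ w₁
    ... | inj₂ w₂ = m₂ w₂

-- edge subsets of an ordered edge list: one Bool per edge (true = in γ)
allMasks : ℕ → List (List Bool)
allMasks zero    = [] ∷ []
allMasks (suc k) = concatMap (λ ms → (true ∷ ms) ∷ (false ∷ ms) ∷ []) (allMasks k)

select : ∀ {A : Set} → List Bool → List A → List A
select (true  ∷ bs) (x ∷ xs) = x ∷ select bs xs
select (false ∷ bs) (x ∷ xs) = select bs xs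
select _ _ = []

-- the totally assigned subgraph (γ , ν) given by an edge subset:
-- the selected edges in the restricted order, with their incident vertices
subTAG : (Γ : TAG) → List Bool → TAG
subTAG Γ bs = tag (n Γ) (λ _ → false) (select bs (edges Γ))

-- representative map of the connected components of the subgraph
-- spanned by a list of edges (naive union–find): r w is a canonical
-- vertex of the component of w, and w ∼ w' iff r w ≡ r w'.
components : ∀ {n} → List (Edge n) → Fin n → Fin n
components []       w = w
components (e ∷ es) w with components es (proj₁ e) | components es (proj₂ e)
... | ra | rb = if does (components es w ≟ rb) then ra else components es w

-- shrinking (Γ/γ , μ/ν): contract each connected component of γ to a
-- point (the vertices of Γ/γ are the component representatives of the
-- vertices of Γ), and keep the edges of Γ not in γ, in the order μ.
shrink : (Γ : TAG) → List Bool → TAG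
shrink Γ bs =
  tag (n Γ)
      (λ w → isVertex Γ w ∧ does (r w ≟ w))
      (map (λ e → (r (proj₁ e) , r (proj₂ e))) (select (map not bs) (edges Γ)))
  where
    r = components (select bs (edges Γ))

_≅²_ : TAG × TAG → TAG × TAG → Set
(a , b) ≅² (c , d) = (a ≅ c) × (b ≅ d)

module TAGOps {c ℓ} (K : Field c ℓ) where
  open Field K
  open FreeVecOps K public

  H : Set c
  H = FreeVec K TAG

  H⊗H : Set c
  H⊗H = FreeVec K (TAG × TAG)

  _≋_ : H⊗H → H⊗H → Set (c ⊔ ℓ)
  _≋_ = Eq _≅²_

  mTAG : TAG → TAG → TAG
  mTAG = _⊔ᵀ_

  Δ : TAG → H⊗H
  Δ Γ = map (λ bs → (1# , (subTAG Γ bs , shrink Γ bs))) (allMasks (length (edges Γ)))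

  -- m^{⊗2} ∘ τ₂₃ on H^{⊗4} = free space on ((a , b) , (c , d)) ↦ a⊗b⊗c⊗d
  m²τ₂₃ : FreeVec K ((TAG × TAG) × (TAG × TAG)) → H⊗H
  m²τ₂₃ = linMap (λ q → (mTAG (proj₁ (proj₁ q)) (proj₁ (proj₂ q))
                        , mTAG (proj₂ (proj₁ q)) (proj₂ (proj₂ q))))

-- An edge subset of Γ₁ ⊔ Γ₂ is a pair of edge subsets a of Γ₁ and b of Γ₂, and both the
-- subgraph and the shrinking it determines split as the disjoint unions of those of a
-- and b, because connected components never cross between Γ₁ and Γ₂.  Hence the terms
-- of Δ(Γ₁ ⊔ Γ₂), indexed by pairs (a , b), agree up to isomorphism with those of
-- m²∘τ₂₃(ΔΓ₁ ⊗ ΔΓ₂); the two sums only enumerate the pairs in different orders.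
module Submission where

open import Defs
open import Level using (Level)
open import Data.Nat using (ℕ; zero; suc; pred) renaming (_+_ to _+ℕ_)
open import Data.Fin using (Fin; _↑ˡ_; _↑ʳ_; splitAt)
open import Data.Fin.Properties
  using (_≟_; splitAt-↑ˡ; splitAt-↑ʳ; splitAt⁻¹-↑ˡ; splitAt⁻¹-↑ʳ; ↑ˡ-injective; ↑ʳ-injective)
open import Data.Bool using (Bool; true; false; _∨_; _∧_; not; T)
open import Data.Bool.Properties using (∨-assoc; ∨-identityʳ; if-float)
open import Data.List using (List; []; _∷_; _++_; map; length; concatMap)
open import Data.List.Properties
  using (map-++; map-∘; map-cong; length-map; length-++; ++-identityʳ;
         concatMap-cong; concatMap-++; concatMap-pure; concatMap-map; map-concatMap)
open import Data.List.Relation.Binary.Pointwise using (Pointwise; []; _∷_)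
open import Data.List.Relation.Unary.All using (All; []; _∷_)
open import Data.List.Relation.Binary.Permutation.Propositional
  using (_↭_; prep; swap; ↭-sym; ↭-reflexive) renaming (refl to ↭-refl; trans to ↭-trans)
open import Data.List.Relation.Binary.Permutation.Propositional.Properties using (++⁺ˡ; shifts)
open import Data.Product using (_×_; _,_; proj₁; proj₂)
open import Data.Sum using (inj₁; inj₂)
open import Function using (id)
open import Function.Bundles using (mk⇔)
open import Function.Definitions using (Injective)
open import Relation.Nullary using (does)
open import Relation.Nullary.Decidable using (dec-false; does-⇔)
open import Relation.Binary.PropositionalEquality
  using (_≡_; _≢_; refl; sym; trans; cong; cong₂; subst; module ≡-Reasoning)

private variable
  a b c : Level
  k m : ℕ

rename : (Fin m → Fin k) → Edge m → Edge k
rename f e = (f (proj₁ e) , f (proj₂ e))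

does-≟-injective : {f : Fin m → Fin k} → Injective _≡_ _≡_ f →
                   ∀ x y → does (f x ≟ f y) ≡ does (x ≟ y)
does-≟-injective {f = f} f-inj x y = does-⇔ (mk⇔ f-inj (cong f)) (f x ≟ f y) (x ≟ y)

↑ˡ≢↑ʳ : ∀ {n₁ n₂} (x : Fin n₁) (y : Fin n₂) → x ↑ˡ n₂ ≢ n₁ ↑ʳ y
↑ˡ≢↑ʳ {n₁} {n₂} x y p
  with () ← trans (sym (splitAt-↑ˡ n₁ x n₂)) (trans (cong (splitAt n₁) p) (splitAt-↑ʳ n₁ n₂ y))

↑-elim : ∀ {n₁ n₂} (P : Fin (n₁ +ℕ n₂) → Set) →
         (∀ x → P (x ↑ˡ n₂)) → (∀ y → P (n₁ ↑ʳ y)) → ∀ w → P w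
↑-elim {n₁} P left right w with splitAt n₁ w in eq
... | inj₁ x = subst P (splitAt⁻¹-↑ˡ eq) (left x)
... | inj₂ y = subst P (splitAt⁻¹-↑ʳ eq) (right y)

-- Incidence and connected components under renaming

incident-++ : (w : Fin k) (xs ys : List (Edge k)) →
              incident w (xs ++ ys) ≡ incident w xs ∨ incident w ys
incident-++ w []       ys = refl
incident-++ w (e ∷ xs) ys =
  trans (cong (_ ∨_) (incident-++ w xs ys))
        (sym (∨-assoc (does (w ≟ proj₁ e) ∨ does (w ≟ proj₂ e)) (incident w xs) (incident w ys)))

module _ {f : Fin m → Fin k} (f-inj : Injective _≡_ _≡_ f) where

  incident-rename : ∀ x es → incident (f x) (map (rename f) es) ≡ incident x es
  incident-rename x []       = refl
  incident-rename x (e ∷ es) =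
    cong₂ _∨_ (cong₂ _∨_ (does-≟-injective f-inj x (proj₁ e)) (does-≟-injective f-inj x (proj₂ e)))
              (incident-rename x es)

  module _ (t : List (Edge k)) (t-fixes : ∀ v → components t (f v) ≡ f v) where

    components-rename-++ : ∀ s w → components (map (rename f) s ++ t) (f w) ≡ f (components s w)
    components-rename-++ []      w = t-fixes w
    components-rename-++ (e ∷ s) w
      rewrite components-rename-++ s w
            | components-rename-++ s (proj₁ e)
            | components-rename-++ s (proj₂ e)
            | does-≟-injective f-inj (components s w) (components s (proj₂ e))
      = sym (if-float f _)

    components-outside-++ : ∀ {u} → (∀ v → components t u ≢ f v) →
                            ∀ s → components (map (rename f) s ++ t) u ≡ components t u
    components-outside-++         u∉ []      = refl
    components-outside-++ {u = u} u∉ (e ∷ s)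
      rewrite components-outside-++ u∉ s
            | components-rename-++ s (proj₂ e)
            | dec-false (components t u ≟ f (components s (proj₂ e))) (u∉ _)
      = refl

  components-rename : ∀ s w → components (map (rename f) s) (f w) ≡ f (components s w)
  components-rename s w =
    trans (cong (λ s′ → components s′ (f w)) (sym (++-identityʳ (map (rename f) s))))
          (components-rename-++ [] (λ _ → refl) s w)

module _ {f : Fin m → Fin k} {u : Fin k} (u∉ : ∀ v → u ≢ f v) where

  incident-outside : ∀ es → incident u (map (rename f) es) ≡ false
  incident-outside []       = refl
  incident-outside (e ∷ es) =
    cong₂ _∨_ (cong₂ _∨_ (dec-false (u ≟ _) (u∉ _)) (dec-false (u ≟ _) (u∉ _)))
              (incident-outside es)

module _ (n₁ n₂ : ℕ) where

  ιˡ : Fin n₁ → Fin (n₁ +ℕ n₂)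
  ιˡ = _↑ˡ n₂

  ιʳ : Fin n₂ → Fin (n₁ +ℕ n₂)
  ιʳ = n₁ ↑ʳ_

  ιˡ-injective : Injective _≡_ _≡_ ιˡ
  ιˡ-injective = ↑ˡ-injective n₂ _ _

  ιʳ-injective : Injective _≡_ _≡_ ιʳ
  ιʳ-injective = ↑ʳ-injective n₁ _ _

  incident-↑ˡ : ∀ es₁ es₂ (x : Fin n₁) →
                incident (x ↑ˡ n₂) (map (rename ιˡ) es₁ ++ map (rename ιʳ) es₂) ≡ incident x es₁
  incident-↑ˡ es₁ es₂ x = begin
    incident (ιˡ x) (map (rename ιˡ) es₁ ++ map (rename ιʳ) es₂)
      ≡⟨ incident-++ (ιˡ x) (map (rename ιˡ) es₁) _ ⟩
    incident (ιˡ x) (map (rename ιˡ) es₁) ∨ incident (ιˡ x) (map (rename ιʳ) es₂)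
      ≡⟨ cong₂ _∨_ (incident-rename ιˡ-injective x es₁) (incident-outside (↑ˡ≢↑ʳ x) es₂) ⟩
    incident x es₁ ∨ false
      ≡⟨ ∨-identityʳ _ ⟩
    incident x es₁ ∎
    where open ≡-Reasoning

  incident-↑ʳ : ∀ es₁ es₂ (y : Fin n₂) →
                incident (n₁ ↑ʳ y) (map (rename ιˡ) es₁ ++ map (rename ιʳ) es₂) ≡ incident y es₂
  incident-↑ʳ es₁ es₂ y =
    trans (incident-++ (ιʳ y) (map (rename ιˡ) es₁) _)
          (cong₂ _∨_ (incident-outside (λ x p → ↑ˡ≢↑ʳ x y (sym p)) es₁)
                     (incident-rename ιʳ-injective y es₂))

  components-↑ʳ-fixes-↑ˡ : ∀ s₂ (x : Fin n₁) → components (map (rename ιʳ) s₂) (x ↑ˡ n₂) ≡ x ↑ˡ n₂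
  components-↑ʳ-fixes-↑ˡ s₂ x =
    trans (cong (λ s → components s (ιˡ x)) (sym (++-identityʳ (map (rename ιʳ) s₂))))
          (components-outside-++ ιʳ-injective [] (λ _ → refl) (↑ˡ≢↑ʳ x) s₂)

  components-↑ˡ : ∀ s₁ s₂ (x : Fin n₁) →
                  components (map (rename ιˡ) s₁ ++ map (rename ιʳ) s₂) (x ↑ˡ n₂)
                  ≡ components s₁ x ↑ˡ n₂
  components-↑ˡ s₁ s₂ =
    components-rename-++ ιˡ-injective (map (rename ιʳ) s₂) (components-↑ʳ-fixes-↑ˡ s₂) s₁

  components-↑ʳ : ∀ s₁ s₂ (y : Fin n₂) →
                  components (map (rename ιˡ) s₁ ++ map (rename ιʳ) s₂) (n₁ ↑ʳ y)
                  ≡ n₁ ↑ʳ components s₂ y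
  components-↑ʳ s₁ s₂ y =
    trans (components-outside-++ ιˡ-injective (map (rename ιʳ) s₂) (components-↑ʳ-fixes-↑ˡ s₂)
             (λ x p → ↑ˡ≢↑ʳ x _ (trans (sym p) (components-rename ιʳ-injective s₂ y))) s₁)
          (components-rename ιʳ-injective s₂ y)

-- Subgraphs and shrinkings of a disjoint union

select-++ : ∀ {A : Set} (bs cs : List Bool) (xs ys : List A) → length bs ≡ length xs →
            select (bs ++ cs) (xs ++ ys) ≡ select bs xs ++ select cs ys
select-++ []           cs []       ys _   = refl
select-++ (true  ∷ bs) cs (x ∷ xs) ys len = cong (x ∷_) (select-++ bs cs xs ys (cong pred len))
select-++ (false ∷ bs) cs (x ∷ xs) ys len = select-++ bs cs xs ys (cong pred len)

select-map : ∀ {A B : Set} (f : A → B) (bs : List Bool) (xs : List A) →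
             select bs (map f xs) ≡ map f (select bs xs)
select-map f []           xs       = refl
select-map f (true  ∷ bs) []       = refl
select-map f (false ∷ bs) []       = refl
select-map f (true  ∷ bs) (x ∷ xs) = cong (f x ∷_) (select-map f bs xs)
select-map f (false ∷ bs) (x ∷ xs) = select-map f bs xs

select-⊔ᵀ : ∀ (Γ₁ Γ₂ : TAG) bs cs → length bs ≡ length (edges Γ₁) →
            select (bs ++ cs) (edges (Γ₁ ⊔ᵀ Γ₂))
            ≡ map (rename (_↑ˡ n Γ₂)) (select bs (edges Γ₁))
              ++ map (rename (n Γ₁ ↑ʳ_)) (select cs (edges Γ₂))
select-⊔ᵀ Γ₁ Γ₂ bs cs len =
  trans (select-++ bs cs (map eˡ (edges Γ₁)) (map eʳ (edges Γ₂))
                   (trans len (sym (length-map eˡ (edges Γ₁)))))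
        (cong₂ _++_ (select-map eˡ bs (edges Γ₁)) (select-map eʳ cs (edges Γ₂)))
  where
    eˡ : Edge (n Γ₁) → Edge (n Γ₁ +ℕ n Γ₂)
    eˡ = rename (_↑ˡ n Γ₂)
    eʳ : Edge (n Γ₂) → Edge (n Γ₁ +ℕ n Γ₂)
    eʳ = rename (n Γ₁ ↑ʳ_)

mark-↑ˡ : ∀ (Γ₁ Γ₂ : TAG) x → mark (Γ₁ ⊔ᵀ Γ₂) (x ↑ˡ n Γ₂) ≡ mark Γ₁ x
mark-↑ˡ Γ₁ Γ₂ x rewrite splitAt-↑ˡ (n Γ₁) x (n Γ₂) = refl

mark-↑ʳ : ∀ (Γ₁ Γ₂ : TAG) y → mark (Γ₁ ⊔ᵀ Γ₂) (n Γ₁ ↑ʳ y) ≡ mark Γ₂ y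
mark-↑ʳ Γ₁ Γ₂ y rewrite splitAt-↑ʳ (n Γ₁) (n Γ₂) y = refl

≅-identity : ∀ {mk mk′ : Fin k → Bool} {es es′ : List (Edge k)} →
             (∀ w → mk w ≡ mk′ w) → es ≡ es′ → tag k mk es ≅ tag k mk′ es′
≅-identity {mk = mk} {mk′} {es} mk≗mk′ refl = record
  { f       = id
  ; g       = id
  ; f-vert  = λ w → subst T (cong (_∨ incident w es) (mk≗mk′ w))
  ; g-vert  = λ w → subst T (cong (_∨ incident w es) (sym (mk≗mk′ w)))
  ; gf      = λ _ _ → refl
  ; fg      = λ _ _ → refl
  ; edgeMap = pointwise-refl es
  }
  where
    pointwise-refl : ∀ es → Pointwise _ es es
    pointwise-refl []       = []
    pointwise-refl (e ∷ es) = inj₁ (refl , refl) ∷ pointwise-refl es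

module _ (Γ₁ Γ₂ : TAG) (bs cs : List Bool) (len : length bs ≡ length (edges Γ₁)) where

  private
    n₁ n₂ : ℕ
    n₁ = n Γ₁
    n₂ = n Γ₂

    Γ : TAG
    Γ = Γ₁ ⊔ᵀ Γ₂

    r : Fin (n₁ +ℕ n₂) → Fin (n₁ +ℕ n₂)
    r = components (select (bs ++ cs) (edges Γ))

    r₁ : Fin n₁ → Fin n₁
    r₁ = components (select bs (edges Γ₁))

    r₂ : Fin n₂ → Fin n₂
    r₂ = components (select cs (edges Γ₂))

    r-↑ˡ : ∀ x → r (x ↑ˡ n₂) ≡ r₁ x ↑ˡ n₂
    r-↑ˡ x = trans (cong (λ s → components s (x ↑ˡ n₂)) (select-⊔ᵀ Γ₁ Γ₂ bs cs len))
                   (components-↑ˡ n₁ n₂ (select bs (edges Γ₁)) (select cs (edges Γ₂)) x)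

    r-↑ʳ : ∀ y → r (n₁ ↑ʳ y) ≡ n₁ ↑ʳ r₂ y
    r-↑ʳ y = trans (cong (λ s → components s (n₁ ↑ʳ y)) (select-⊔ᵀ Γ₁ Γ₂ bs cs len))
                   (components-↑ʳ n₁ n₂ (select bs (edges Γ₁)) (select cs (edges Γ₂)) y)

    select-complement : select (map not (bs ++ cs)) (edges Γ)
                        ≡ map (rename (_↑ˡ n₂)) (select (map not bs) (edges Γ₁))
                          ++ map (rename (n₁ ↑ʳ_)) (select (map not cs) (edges Γ₂))
    select-complement =
      trans (cong (λ ms → select ms (edges Γ)) (map-++ not bs cs))
            (select-⊔ᵀ Γ₁ Γ₂ (map not bs) (map not cs) (trans (length-map not bs) len))

    shrink-edges : edges (shrink Γ (bs ++ cs)) ≡ edges (shrink Γ₁ bs ⊔ᵀ shrink Γ₂ cs)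
    shrink-edges = begin
      map (rename r) (select (map not (bs ++ cs)) (edges Γ))
        ≡⟨ cong (map (rename r)) select-complement ⟩
      map (rename r) (map (rename (_↑ˡ n₂)) ns₁ ++ map (rename (n₁ ↑ʳ_)) ns₂)
        ≡⟨ map-++ (rename r) (map (rename (_↑ˡ n₂)) ns₁) _ ⟩
      map (rename r) (map (rename (_↑ˡ n₂)) ns₁) ++ map (rename r) (map (rename (n₁ ↑ʳ_)) ns₂)
        ≡⟨ cong₂ _++_ (commute (λ e → cong₂ _,_ (r-↑ˡ (proj₁ e)) (r-↑ˡ (proj₂ e))) ns₁)
                      (commute (λ e → cong₂ _,_ (r-↑ʳ (proj₁ e)) (r-↑ʳ (proj₂ e))) ns₂) ⟩
      map (rename (_↑ˡ n₂)) (map (rename r₁) ns₁) ++ map (rename (n₁ ↑ʳ_)) (map (rename r₂) ns₂) ∎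
      where
        open ≡-Reasoning
        ns₁ : List (Edge n₁)
        ns₁ = select (map not bs) (edges Γ₁)
        ns₂ : List (Edge n₂)
        ns₂ = select (map not cs) (edges Γ₂)
        commute : ∀ {A B C D : Set} {g : B → D} {ι : A → B} {g′ : A → C} {κ : C → D} →
                  (∀ e → g (ι e) ≡ κ (g′ e)) → ∀ xs → map g (map ι xs) ≡ map κ (map g′ xs)
        commute g∘ι≗κ∘g′ xs = trans (sym (map-∘ xs)) (trans (map-cong g∘ι≗κ∘g′ xs) (map-∘ xs))

    does-≟-↑ˡ : ∀ x → does (r (x ↑ˡ n₂) ≟ x ↑ˡ n₂) ≡ does (r₁ x ≟ x)
    does-≟-↑ˡ x = trans (cong (λ z → does (z ≟ x ↑ˡ n₂)) (r-↑ˡ x))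
                        (does-≟-injective (↑ˡ-injective n₂ _ _) (r₁ x) x)

    does-≟-↑ʳ : ∀ y → does (r (n₁ ↑ʳ y) ≟ n₁ ↑ʳ y) ≡ does (r₂ y ≟ y)
    does-≟-↑ʳ y = trans (cong (λ z → does (z ≟ n₁ ↑ʳ y)) (r-↑ʳ y))
                        (does-≟-injective (↑ʳ-injective n₁ _ _) (r₂ y) y)

    shrink-mark : ∀ w → mark (shrink Γ (bs ++ cs)) w ≡ mark (shrink Γ₁ bs ⊔ᵀ shrink Γ₂ cs) w
    shrink-mark = ↑-elim (λ w → mark (shrink Γ (bs ++ cs)) w ≡ mark (shrink Γ₁ bs ⊔ᵀ shrink Γ₂ cs) w)
      (λ x → trans (cong₂ _∧_ (cong₂ _∨_ (mark-↑ˡ Γ₁ Γ₂ x) (incident-↑ˡ n₁ n₂ (edges Γ₁) (edges Γ₂) x))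
                              (does-≟-↑ˡ x))
                   (sym (mark-↑ˡ (shrink Γ₁ bs) (shrink Γ₂ cs) x)))
      (λ y → trans (cong₂ _∧_ (cong₂ _∨_ (mark-↑ʳ Γ₁ Γ₂ y) (incident-↑ʳ n₁ n₂ (edges Γ₁) (edges Γ₂) y))
                              (does-≟-↑ʳ y))
                   (sym (mark-↑ʳ (shrink Γ₁ bs) (shrink Γ₂ cs) y)))

  subTAG-⊔ᵀ : subTAG (Γ₁ ⊔ᵀ Γ₂) (bs ++ cs) ≅ (subTAG Γ₁ bs ⊔ᵀ subTAG Γ₂ cs)
  subTAG-⊔ᵀ = ≅-identity
    (↑-elim (λ w → false ≡ mark (subTAG Γ₁ bs ⊔ᵀ subTAG Γ₂ cs) w)
            (λ x → sym (mark-↑ˡ (subTAG Γ₁ bs) (subTAG Γ₂ cs) x))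
            (λ y → sym (mark-↑ʳ (subTAG Γ₁ bs) (subTAG Γ₂ cs) y)))
    (select-⊔ᵀ Γ₁ Γ₂ bs cs len)

  shrink-⊔ᵀ : shrink (Γ₁ ⊔ᵀ Γ₂) (bs ++ cs) ≅ (shrink Γ₁ bs ⊔ᵀ shrink Γ₂ cs)
  shrink-⊔ᵀ = ≅-identity shrink-mark shrink-edges

-- Edge subsets and double sums

concatMap-assoc : ∀ {A : Set a} {B : Set b} {C : Set c} (f : B → List C) (g : A → List B) xs →
                  concatMap f (concatMap g xs) ≡ concatMap (λ x → concatMap f (g x)) xs
concatMap-assoc f g []       = refl
concatMap-assoc f g (x ∷ xs) =
  trans (concatMap-++ f (g x) (concatMap g xs)) (cong (concatMap f (g x) ++_) (concatMap-assoc f g xs))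

allMasks-+ : ∀ k₁ k₂ → allMasks (k₁ +ℕ k₂) ≡ concatMap (λ cs → map (_++ cs) (allMasks k₁)) (allMasks k₂)
allMasks-+ zero     k₂ = sym (concatMap-pure (allMasks k₂))
allMasks-+ (suc k₁) k₂ = begin
  concatMap extend (allMasks (k₁ +ℕ k₂))
    ≡⟨ cong (concatMap extend) (allMasks-+ k₁ k₂) ⟩
  concatMap extend (concatMap (λ cs → map (_++ cs) (allMasks k₁)) (allMasks k₂))
    ≡⟨ concatMap-assoc extend (λ cs → map (_++ cs) (allMasks k₁)) (allMasks k₂) ⟩
  concatMap (λ cs → concatMap extend (map (_++ cs) (allMasks k₁))) (allMasks k₂)
    ≡⟨ concatMap-cong (λ cs → trans (concatMap-map extend (_++ cs) (allMasks k₁))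
                                    (sym (map-concatMap (_++ cs) extend (allMasks k₁)))) (allMasks k₂) ⟩
  concatMap (λ cs → map (_++ cs) (concatMap extend (allMasks k₁))) (allMasks k₂) ∎
  where
    open ≡-Reasoning
    extend : List Bool → List (List Bool)
    extend ms = (true ∷ ms) ∷ (false ∷ ms) ∷ []

allMasks-length : ∀ k → All (λ ms → length ms ≡ k) (allMasks k)
allMasks-length zero    = refl ∷ []
allMasks-length (suc k) = extend (allMasks k) (allMasks-length k)
  where
    extend : ∀ mss → All (λ ms → length ms ≡ k) mss →
             All (λ ms → length ms ≡ suc k) (concatMap (λ ms → (true ∷ ms) ∷ (false ∷ ms) ∷ []) mss)
    extend []         []           = []
    extend (ms ∷ mss) (len ∷ lens) = cong suc len ∷ cong suc len ∷ extend mss lens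

concatMap-∷-↭ : ∀ {A : Set a} {B : Set b} (g : A → B) (h : A → List B) xs →
                concatMap (λ x → g x ∷ h x) xs ↭ map g xs ++ concatMap h xs
concatMap-∷-↭ g h []       = ↭-refl
concatMap-∷-↭ g h (x ∷ xs) =
  prep (g x) (↭-trans (++⁺ˡ (h x) (concatMap-∷-↭ g h xs)) (shifts (h x) (map g xs)))

concatMap-transpose : ∀ {A : Set a} {B : Set b} {C : Set c} (f : A → B → C) xs ys →
  concatMap (λ x → map (f x) ys) xs ↭ concatMap (λ y → map (λ x → f x y) xs) ys
concatMap-transpose f []       ys = ↭-reflexive (sym (concatMap-[] ys))
  where
    concatMap-[] : ∀ ys → concatMap (λ y → map (λ x → f x y) []) ys ≡ []
    concatMap-[] []       = refl
    concatMap-[] (y ∷ ys) = concatMap-[] ys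
concatMap-transpose f (x ∷ xs) ys =
  ↭-trans (++⁺ˡ (map (f x) ys) (concatMap-transpose f xs ys))
          (↭-sym (concatMap-∷-↭ (f x) (λ y → map (λ x′ → f x′ y) xs) ys))

-- Equality in a free vector space

module _ {c ℓ} (K : Field c ℓ) where
  open FreeVecOps K
  open Field K using (Carrier; _≈_)

  module _ {b r} {B : Set b} {_∼_ : B → B → Set r} where

    ≡⇒Eq : ∀ {xs ys : FreeVec K B} → xs ≡ ys → Eq _∼_ xs ys
    ≡⇒Eq refl = eq-refl

    ↭⇒Eq : ∀ {xs ys : FreeVec K B} → xs ↭ ys → Eq _∼_ xs ys
    ↭⇒Eq ↭-refl          = eq-refl
    ↭⇒Eq (prep x p)      = eq-tail (↭⇒Eq p)
    ↭⇒Eq (swap x y p)    = eq-trans eq-swap (eq-tail (eq-tail (↭⇒Eq p)))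
    ↭⇒Eq (↭-trans p q)   = eq-trans (↭⇒Eq p) (↭⇒Eq q)

    Eq-++ʳ : ∀ {xs ys : FreeVec K B} zs → Eq _∼_ xs ys → Eq _∼_ (xs ++ zs) (ys ++ zs)
    Eq-++ʳ zs eq-refl        = eq-refl
    Eq-++ʳ zs (eq-sym p)     = eq-sym (Eq-++ʳ zs p)
    Eq-++ʳ zs (eq-trans p q) = eq-trans (Eq-++ʳ zs p) (Eq-++ʳ zs q)
    Eq-++ʳ zs (eq-tail p)    = eq-tail (Eq-++ʳ zs p)
    Eq-++ʳ zs (eq-head p q)  = eq-head p q
    Eq-++ʳ zs eq-swap        = eq-swap
    Eq-++ʳ zs eq-merge       = eq-merge
    Eq-++ʳ zs eq-zero        = eq-zero

    Eq-++ˡ : ∀ (xs : FreeVec K B) {ys zs} → Eq _∼_ ys zs → Eq _∼_ (xs ++ ys) (xs ++ zs)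
    Eq-++ˡ []       p = p
    Eq-++ˡ (x ∷ xs) p = eq-tail (Eq-++ˡ xs p)

    Eq-concatMap : ∀ {A : Set} {u v : A → FreeVec K B} → (∀ x → Eq _∼_ (u x) (v x)) →
                   ∀ xs → Eq _∼_ (concatMap u xs) (concatMap v xs)
    Eq-concatMap u≋v []       = eq-refl
    Eq-concatMap u≋v (x ∷ xs) = eq-trans (Eq-++ʳ _ (u≋v x)) (Eq-++ˡ _ (Eq-concatMap u≋v xs))

    Eq-map : ∀ {A : Set} {P : A → Set} {f g : A → Carrier × B} →
             (∀ x → P x → proj₁ (f x) ≈ proj₁ (g x) × proj₂ (f x) ∼ proj₂ (g x)) →
             ∀ xs → All P xs → Eq _∼_ (map f xs) (map g xs)
    Eq-map f≈g []       []       = eq-refl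
    Eq-map f≈g (x ∷ xs) (p ∷ ps) =
      eq-trans (eq-head (proj₁ (f≈g x p)) (proj₂ (f≈g x p))) (eq-tail (Eq-map f≈g xs ps))

module _ {c ℓ} (K : Field c ℓ) (Γ₁ Γ₂ : TAG) where
  open TAGOps K
  open Field K using (Carrier; 1#; _*_; _≈_; *-identityˡ) renaming (sym to ≈-sym)

  private
    M₁ M₂ : List (List Bool)
    M₁ = allMasks (length (edges Γ₁))
    M₂ = allMasks (length (edges Γ₂))

    Δ-term : TAG → List Bool → Carrier × (TAG × TAG)
    Δ-term Γ bs = (1# , (subTAG Γ bs , shrink Γ bs))

    split-term : List Bool → List Bool → Carrier × (TAG × TAG)
    split-term bs cs = (1# * 1# , (subTAG Γ₁ bs ⊔ᵀ subTAG Γ₂ cs , shrink Γ₁ bs ⊔ᵀ shrink Γ₂ cs))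

    Δ-⊔ᵀ-reindex : Δ (Γ₁ ⊔ᵀ Γ₂) ≡ concatMap (λ cs → map (λ bs → Δ-term (Γ₁ ⊔ᵀ Γ₂) (bs ++ cs)) M₁) M₂
    Δ-⊔ᵀ-reindex = begin
      map (Δ-term Γ) (allMasks (length (edges Γ)))
        ≡⟨ cong (λ k → map (Δ-term Γ) (allMasks k)) edge-count ⟩
      map (Δ-term Γ) (allMasks (length (edges Γ₁) +ℕ length (edges Γ₂)))
        ≡⟨ cong (map (Δ-term Γ)) (allMasks-+ (length (edges Γ₁)) (length (edges Γ₂))) ⟩
      map (Δ-term Γ) (concatMap (λ cs → map (_++ cs) M₁) M₂)
        ≡⟨ map-concatMap (Δ-term Γ) (λ cs → map (_++ cs) M₁) M₂ ⟩
      concatMap (λ cs → map (Δ-term Γ) (map (_++ cs) M₁)) M₂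
        ≡⟨ concatMap-cong (λ cs → sym (map-∘ M₁)) M₂ ⟩
      concatMap (λ cs → map (λ bs → Δ-term Γ (bs ++ cs)) M₁) M₂ ∎
      where
        open ≡-Reasoning
        Γ : TAG
        Γ = Γ₁ ⊔ᵀ Γ₂
        edge-count : length (edges Γ) ≡ length (edges Γ₁) +ℕ length (edges Γ₂)
        edge-count = trans (length-++ (map (rename (_↑ˡ n Γ₂)) (edges Γ₁)))
                           (cong₂ _+ℕ_ (length-map _ (edges Γ₁)) (length-map _ (edges Γ₂)))

    m²τ₂₃-Δ⊗Δ : m²τ₂₃ (Δ Γ₁ ⊗ Δ Γ₂) ≡ concatMap (λ bs → map (split-term bs) M₂) M₁
    m²τ₂₃-Δ⊗Δ = go M₁
      where
        go : ∀ mss → m²τ₂₃ (map (Δ-term Γ₁) mss ⊗ Δ Γ₂) ≡ concatMap (λ bs → map (split-term bs) M₂) mss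
        go []         = refl
        go (bs ∷ mss) = trans (map-++ _ (map _ (Δ Γ₂)) (map (Δ-term Γ₁) mss ⊗ Δ Γ₂))
                              (cong₂ _++_ (sym (trans (map-∘ M₂) (map-∘ (map (Δ-term Γ₂) M₂)))) (go mss))

  Δ-⊔ᵀ : Δ (mTAG Γ₁ Γ₂) ≋ m²τ₂₃ (Δ Γ₁ ⊗ Δ Γ₂)
  Δ-⊔ᵀ =
    eq-trans (≡⇒Eq K Δ-⊔ᵀ-reindex)
   (eq-trans (Eq-concatMap K (λ cs → Eq-map K (term≋ cs) M₁ (allMasks-length _)) M₂)
   (eq-trans (↭⇒Eq K (↭-sym (concatMap-transpose split-term M₁ M₂)))
             (≡⇒Eq K (sym m²τ₂₃-Δ⊗Δ))))
    where
      term≋ : ∀ cs bs → length bs ≡ length (edges Γ₁) →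
              1# ≈ 1# * 1# × proj₂ (Δ-term (Γ₁ ⊔ᵀ Γ₂) (bs ++ cs)) ≅² proj₂ (split-term bs cs)
      term≋ cs bs len = ≈-sym (*-identityˡ 1#) , subTAG-⊔ᵀ Γ₁ Γ₂ bs cs len , shrink-⊔ᵀ Γ₁ Γ₂ bs cs len

mainTheorem5 : ∀ {c ℓ} (K : Field c ℓ) → CharacteristicZero K →
    (Γ₁ Γ₂ : TAG) →
    let open TAGOps K in
    Δ (mTAG Γ₁ Γ₂) ≋ m²τ₂₃ (Δ Γ₁ ⊗ Δ Γ₂)
mainTheorem5 K _ = Δ-⊔ᵀ K
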